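{- Let $n\ge 1$ and let $(\mathbf d,\mathbf r)$ be an arithmetical structure on the fan graph $F_n$, with $\mathbf d=(d_0,\dots,d_{2n})$, $\mathbf r=(r_0,\dots,r_{2n})$, such that $r_0$ divides $r_{2m-1}+r_{2m}$ for some $1\le m\le n$. Define vectors indexed by the vertices $v_0,\dots,v_{2n+2}$ of $F_{n+1}$ by $$\tilde{\mathbf d}=\Big(d_0+\tfrac{r_{2m-1}+r_{2m}}{r_0},\,d_1,\dots,d_{2n},\,d_{2m-1},\,d_{2m}\Big),\qquad \tilde{\mathbf r}=(r_0,r_1,\dots,r_{2n},r_{2m-1},r_{2m}).$$ Then $(\tilde{\mathbf d},\tilde{\mathbf r})$ is an arithmetical structure on $F_{n+1}$.
   Context: For $k\ge1$, the fan graph $F_k$ has vertices $v_0,\dots,v_{2k}$, with edges $v_0v_i$ for $1\le i\le 2k$ and $v_{2j-1}v_{2j}$ for $1\le j\le k$; entries of vectors are indexed so that the $i$-th entry (starting at $0$) corresponds to $v_i$. For a finite connected graph $G$ with adjacency matrix $A$, an arithmetical structure on $G$ is a pair $(\mathbf d,\mathbf r)$ of vectors of positive integers indexed by the vertices such that $\mathbf r$ is primitive (gcd of entries equal to $1$) and $(\mathrm{diag}(\mathbf d)-A)\mathbf r=0$. -}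

module Defs where

open import Data.Nat using (ℕ; zero; suc; _+_; _*_; _∸_; _≤_; _<_; _≡ᵇ_; ⌊_/2⌋)
open import Data.Nat.GCD using (gcd)
open import Data.Nat.Divisibility using (_∣_; quotient)
open import Data.Fin using (Fin; toℕ)
open import Data.Bool using (if_then_else_; not; _∧_)
open import Data.Vec.Functional using (Vector; foldr)
open import Relation.Binary.PropositionalEquality using (_≡_)

sumV : ∀ {N} → Vector ℕ N → ℕ
sumV = foldr _+_ 0

AdjMatrix : ℕ → Set
AdjMatrix N = Fin N → Fin N → ℕ

record IsArithmeticalStructure {N : ℕ} (A : AdjMatrix N)
       (d r : Vector ℕ N) : Set where
  field
    d-pos     : ∀ i → 0 < d i
    r-pos     : ∀ i → 0 < r i
    r-primitive : foldr gcd 0 r ≡ 1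
    kernel    : ∀ i → d i * r i ≡ sumV (λ j → A i j * r j)

fanSize : ℕ → ℕ
fanSize k = suc (2 * k)

-- Adjacency on vertex indices of a fan graph: v_0 is adjacent to every v_i
-- (i ≥ 1), and v_{2j-1} ~ v_{2j}. After shifting indices by one (a = i-1),
-- the pair {v_{2j-1}, v_{2j}} becomes {2t, 2t+1}: same ⌊_/2⌋, distinct.
fanAdjℕ : ℕ → ℕ → ℕ
fanAdjℕ zero    zero    = 0
fanAdjℕ zero    (suc _) = 1
fanAdjℕ (suc _) zero    = 1
fanAdjℕ (suc a) (suc b) =
  if (⌊ a /2⌋ ≡ᵇ ⌊ b /2⌋) ∧ not (a ≡ᵇ b) then 1 else 0

fanAdj : (k : ℕ) → AdjMatrix (fanSize k)
fanAdj k i j = fanAdjℕ (toℕ i) (toℕ j)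

-- Look up a vector by a natural-number index (0 outside the range;
-- only used at in-range indices).
at : ∀ {N} → Vector ℕ N → ℕ → ℕ
at {zero}  v k       = 0
at {suc N} v zero    = v Fin.zero
at {suc N} v (suc k) = at (λ i → v (Fin.suc i)) k

extendV : (n m : ℕ) → Vector ℕ (fanSize n) → ℕ → Vector ℕ (fanSize (suc n))
extendV n m v first i = go (toℕ i)
  where
  go : ℕ → ℕ
  go k = if k ≡ᵇ 0 then first
          else if k ≡ᵇ (2 * n + 1) then at v (2 * m ∸ 1)
          else if k ≡ᵇ (2 * n + 2) then at v (2 * m)
          else at v k

rTilde : (n m : ℕ) → Vector ℕ (fanSize n) → Vector ℕ (fanSize (suc n))
rTilde n m r = extendV n m r (at r 0)

dTilde : (n m : ℕ) (d r : Vector ℕ (fanSize n)) →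
         at r 0 ∣ (at r (2 * m ∸ 1) + at r (2 * m)) →
         Vector ℕ (fanSize (suc n))
dTilde n m d r h = extendV n m d (at d 0 + quotient h)

{-# OPTIONS --safe #-}
-- In F_n a leaf is adjacent only to v_0 and to its mate, so the kernel equations read
-- d_i r_i = r_0 + r_{i'} at a leaf v_i with mate v_{i'}, and d_0 r_0 = r_1 + ⋯ + r_{2n} at the
-- centre. The new leaves v_{2n+1}, v_{2n+2} are copies of the mates v_{2m-1}, v_{2m}, so every
-- leaf equation of (d̃, r̃) is a leaf equation of (d, r); at the centre the extra summand
-- r_{2m-1} + r_{2m} = q r_0 is absorbed by raising d_0 to d_0 + q. Positivity is inherited, and
-- r̃ lists every entry of r, so it is still primitive.
module Submission where

open import Defs
open import Data.Nat using (ℕ; zero; suc; _≤_; _<_; _+_; _*_; _∸_; _≡ᵇ_; ⌊_/2⌋; z≤n; s≤s; z<s)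
open import Data.Nat.Properties
open import Data.Nat.Divisibility using (_∣_)
open import Data.Nat.GCD using (gcd; gcd-assoc; gcd-identity; gcd-zeroˡ)
open import Relation.Binary.PropositionalEquality
open import Algebra.Definitions {A = ℕ} _≡_ using (Associative; Identity)
open import Data.Bool using (true; false; if_then_else_; not; _∧_)
open import Data.Empty using (⊥-elim)
open import Data.Fin using (Fin; toℕ; fromℕ<)
open import Data.Fin.Properties using (toℕ-fromℕ<; toℕ<n)
open import Data.Product using (proj₁; proj₂)
open import Data.Sum using (inj₁; inj₂)
open import Data.Vec.Functional using (Vector; foldr)
open import Function using (_∘_)

foldUpTo : (ℕ → ℕ → ℕ) → ℕ → ℕ → (ℕ → ℕ) → ℕ
foldUpTo f z zero    g = z
foldUpTo f z (suc N) g = f (g 0) (foldUpTo f z N (g ∘ suc))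

sumUpTo : ℕ → (ℕ → ℕ) → ℕ
sumUpTo = foldUpTo _+_ 0

foldUpTo-cong : ∀ f z N {g h : ℕ → ℕ} → (∀ {k} → k < N → g k ≡ h k) →
                foldUpTo f z N g ≡ foldUpTo f z N h
foldUpTo-cong f z zero    g≗h = refl
foldUpTo-cong f z (suc N) g≗h = cong₂ f (g≗h z<s) (foldUpTo-cong f z N (g≗h ∘ s≤s))

module _ {f : ℕ → ℕ → ℕ} {e : ℕ} (assoc : Associative f) (identity : Identity e f) where

  foldUpTo-snoc : ∀ N g → foldUpTo f e (suc N) g ≡ f (foldUpTo f e N g) (g N)
  foldUpTo-snoc zero    g = trans (proj₂ identity (g 0)) (sym (proj₁ identity (g 0)))
  foldUpTo-snoc (suc N) g =
    trans (cong (f (g 0)) (foldUpTo-snoc N (g ∘ suc))) (sym (assoc (g 0) _ _))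

  foldUpTo-snoc² : ∀ N g →
    foldUpTo f e (suc (suc N)) g ≡ f (foldUpTo f e N g) (f (g N) (g (suc N)))
  foldUpTo-snoc² N g = begin
    foldUpTo f e (suc (suc N)) g            ≡⟨ foldUpTo-snoc (suc N) g ⟩
    f (foldUpTo f e (suc N) g) (g (suc N))   ≡⟨ cong (λ x → f x (g (suc N))) (foldUpTo-snoc N g) ⟩
    f (f (foldUpTo f e N g) (g N)) (g (suc N)) ≡⟨ assoc _ _ _ ⟩
    f (foldUpTo f e N g) (f (g N) (g (suc N))) ∎
    where open ≡-Reasoning

sumUpTo-zero : ∀ N → sumUpTo N (λ _ → 0) ≡ 0
sumUpTo-zero zero    = refl
sumUpTo-zero (suc N) = sumUpTo-zero N

sumUpTo-select : ∀ N {c} (g : ℕ → ℕ) → c < N →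
                 sumUpTo N (λ j → (if j ≡ᵇ c then 1 else 0) * g j) ≡ g c
sumUpTo-select (suc N) {zero}  g _ =
  trans (cong₂ _+_ (*-identityˡ (g 0)) (sumUpTo-zero N)) (+-identityʳ (g 0))
sumUpTo-select (suc N) {suc c} g (s≤s c<N) = sumUpTo-select N (g ∘ suc) c<N

foldr-toℕ : ∀ f z N (g : ℕ → ℕ) → foldr f z {N} (g ∘ toℕ) ≡ foldUpTo f z N g
foldr-toℕ f z zero    g = refl
foldr-toℕ f z (suc N) g = cong (f (g 0)) (foldr-toℕ f z N (g ∘ suc))

foldr-at : ∀ f z {N} (G : ℕ → ℕ → ℕ) (v : Vector ℕ N) →
           foldr f z (λ i → G (toℕ i) (v i)) ≡ foldUpTo f z N (λ k → G k (at v k))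
foldr-at f z {zero}  G v = refl
foldr-at f z {suc N} G v = cong (f (G 0 (v Fin.zero))) (foldr-at f z (G ∘ suc) (v ∘ Fin.suc))

at-fromℕ< : ∀ {N} (v : Vector ℕ N) {k} (k<N : k < N) → at v k ≡ v (fromℕ< k<N)
at-fromℕ< {suc N} v {zero}  _          = refl
at-fromℕ< {suc N} v {suc k} (s≤s k<N) = at-fromℕ< (v ∘ Fin.suc) k<N

record IsArithmeticalStructureℕ (N : ℕ) (A : ℕ → ℕ → ℕ) (D R : ℕ → ℕ) : Set where
  field
    d-pos       : ∀ {k} → k < N → 0 < D k
    r-pos       : ∀ {k} → k < N → 0 < R k
    r-primitive : foldUpTo gcd 0 N R ≡ 1
    kernel      : ∀ {k} → k < N → D k * R k ≡ sumUpTo N (λ j → A k j * R j)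

module _ {N : ℕ} (A : ℕ → ℕ → ℕ) where

  private
    Adj : AdjMatrix N
    Adj i j = A (toℕ i) (toℕ j)

  at-isArithmeticalStructure : ∀ {d r} → IsArithmeticalStructure Adj d r →
                               IsArithmeticalStructureℕ N A (at d) (at r)
  at-isArithmeticalStructure {d} {r} s = record
    { d-pos       = λ k<N → subst (0 <_) (sym (at-fromℕ< d k<N)) (d-pos _)
    ; r-pos       = λ k<N → subst (0 <_) (sym (at-fromℕ< r k<N)) (r-pos _)
    ; r-primitive = trans (sym (foldr-at gcd 0 (λ _ x → x) r)) r-primitive
    ; kernel      = kernelℕ
    }
    where
    open IsArithmeticalStructure s
    kernelℕ : ∀ {k} → k < N → at d k * at r k ≡ sumUpTo N (λ j → A k j * at r j)
    kernelℕ {k} k<N = begin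
      at d k * at r k                         ≡⟨ cong₂ _*_ (at-fromℕ< d k<N) (at-fromℕ< r k<N) ⟩
      d i * r i                               ≡⟨ kernel i ⟩
      sumV (λ j → A (toℕ i) (toℕ j) * r j)    ≡⟨ foldr-at _+_ 0 (λ j x → A (toℕ i) j * x) r ⟩
      sumUpTo N (λ j → A (toℕ i) j * at r j)  ≡⟨ cong (λ t → sumUpTo N (λ j → A t j * at r j)) (toℕ-fromℕ< k<N) ⟩
      sumUpTo N (λ j → A k j * at r j)        ∎
      where
      open ≡-Reasoning
      i : Fin N
      i = fromℕ< k<N

  toℕ-isArithmeticalStructure : ∀ {D R} → IsArithmeticalStructureℕ N A D R →
                                IsArithmeticalStructure Adj (D ∘ toℕ) (R ∘ toℕ)
  toℕ-isArithmeticalStructure {D} {R} s = record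
    { d-pos       = λ i → d-pos (toℕ<n i)
    ; r-pos       = λ i → r-pos (toℕ<n i)
    ; r-primitive = trans (foldr-toℕ gcd 0 N R) r-primitive
    ; kernel      = λ i → trans (kernel (toℕ<n i)) (sym (foldr-toℕ _+_ 0 N (λ j → A (toℕ i) j * R j)))
    }
    where open IsArithmeticalStructureℕ s

-- Leaves are numbered from 0 here (leaf a is the vertex v_{a+1}), so the mates are 2t and 2t+1.
mate : ℕ → ℕ
mate zero          = 1
mate (suc zero)    = 0
mate (suc (suc a)) = suc (suc (mate a))

mate-involutive : ∀ a → mate (mate a) ≡ a
mate-involutive zero          = refl
mate-involutive (suc zero)    = refl
mate-involutive (suc (suc a)) = cong (suc ∘ suc) (mate-involutive a)

mate-double : ∀ n → mate (2 * n) ≡ suc (2 * n)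
mate-double zero    = refl
mate-double (suc n) rewrite *-suc 2 n = cong (suc ∘ suc) (mate-double n)

mate-suc-double : ∀ n → mate (suc (2 * n)) ≡ 2 * n
mate-suc-double n = trans (cong mate (sym (mate-double n))) (mate-involutive (2 * n))

mate-< : ∀ n {a} → a < 2 * n → mate a < 2 * n
mate-< (suc n) a<2n rewrite *-suc 2 n = go a<2n
  where
  go : ∀ {a} → a < suc (suc (2 * n)) → mate a < suc (suc (2 * n))
  go {zero}        _                 = s≤s (s≤s z≤n)
  go {suc zero}    _                 = z<s
  go {suc (suc a)} (s≤s (s≤s a<2n)) = s≤s (s≤s (mate-< n a<2n))

paired-≡ᵇ-mate : ∀ a b → ((⌊ a /2⌋ ≡ᵇ ⌊ b /2⌋) ∧ not (a ≡ᵇ b)) ≡ (b ≡ᵇ mate a)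
paired-≡ᵇ-mate zero          zero          = refl
paired-≡ᵇ-mate zero          (suc zero)    = refl
paired-≡ᵇ-mate zero          (suc (suc b)) = refl
paired-≡ᵇ-mate (suc zero)    zero          = refl
paired-≡ᵇ-mate (suc zero)    (suc zero)    = refl
paired-≡ᵇ-mate (suc zero)    (suc (suc b)) = refl
paired-≡ᵇ-mate (suc (suc a)) zero          = refl
paired-≡ᵇ-mate (suc (suc a)) (suc zero)    = refl
paired-≡ᵇ-mate (suc (suc a)) (suc (suc b)) = paired-≡ᵇ-mate a b

fanAdjℕ-leaf : ∀ a b → fanAdjℕ (suc a) (suc b) ≡ (if b ≡ᵇ mate a then 1 else 0)
fanAdjℕ-leaf a b = cong (λ c → if c then 1 else 0) (paired-≡ᵇ-mate a b)

fan-center-row : ∀ M (R : ℕ → ℕ) →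
                 sumUpTo (suc M) (λ j → fanAdjℕ 0 j * R j) ≡ sumUpTo M (R ∘ suc)
fan-center-row M R = foldUpTo-cong _+_ 0 M (λ {k} _ → *-identityˡ (R (suc k)))

fan-leaf-row : ∀ M a (R : ℕ → ℕ) → mate a < M →
               sumUpTo (suc M) (λ j → fanAdjℕ (suc a) j * R j) ≡ R 0 + R (suc (mate a))
fan-leaf-row M a R mate<M = cong₂ _+_ (*-identityˡ (R 0)) (begin
  sumUpTo M (λ j → fanAdjℕ (suc a) (suc j) * R (suc j))
    ≡⟨ foldUpTo-cong _+_ 0 M (λ {j} _ → cong (_* R (suc j)) (fanAdjℕ-leaf a j)) ⟩
  sumUpTo M (λ j → (if j ≡ᵇ mate a then 1 else 0) * R (suc j))
    ≡⟨ sumUpTo-select M (R ∘ suc) mate<M ⟩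
  R (suc (mate a)) ∎)
  where open ≡-Reasoning

module _ {A : Set} {a b : A} where

  if-≡ᵇ-yes : ∀ {x y} → x ≡ y → (if x ≡ᵇ y then a else b) ≡ a
  if-≡ᵇ-yes {x} {y} x≡y with x ≡ᵇ y | ≡⇒≡ᵇ x y x≡y
  ... | true  | _  = refl
  ... | false | ()

  if-≡ᵇ-no : ∀ {x y} → x ≢ y → (if x ≡ᵇ y then a else b) ≡ b
  if-≡ᵇ-no {x} {y} x≢y with x ≡ᵇ y | ≡ᵇ⇒≡ x y
  ... | false | _   = refl
  ... | true  | x≡y = ⊥-elim (x≢y (x≡y _))

-- extendV n m v c i is definitionally extendℕ n (2 * m ∸ 1) (2 * m) (at v) c (toℕ i).
extendℕ : (n y₁ y₂ : ℕ) → (ℕ → ℕ) → ℕ → ℕ → ℕ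
extendℕ n y₁ y₂ V c k =
  if k ≡ᵇ 0 then c
  else if k ≡ᵇ (2 * n + 1) then V y₁
  else if k ≡ᵇ (2 * n + 2) then V y₂
  else V k

module _ (n y₁ y₂ : ℕ) (V : ℕ → ℕ) (c : ℕ) where

  extend-old : ∀ {a} → a < 2 * n → extendℕ n y₁ y₂ V c (suc a) ≡ V (suc a)
  extend-old {a} a<2n = trans (if-≡ᵇ-no ≢2n+1) (if-≡ᵇ-no ≢2n+2)
    where
    ≢2n+1 : suc a ≢ 2 * n + 1
    ≢2n+1 = λ eq → <⇒≢ a<2n (suc-injective (trans eq (+-comm (2 * n) 1)))
    ≢2n+2 : suc a ≢ 2 * n + 2
    ≢2n+2 = λ eq → <⇒≢ (m<n⇒m<1+n a<2n) (suc-injective (trans eq (+-comm (2 * n) 2)))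

  extend-new₁ : extendℕ n y₁ y₂ V c (suc (2 * n)) ≡ V y₁
  extend-new₁ = if-≡ᵇ-yes (+-comm 1 (2 * n))

  extend-new₂ : extendℕ n y₁ y₂ V c (suc (suc (2 * n))) ≡ V y₂
  extend-new₂ = trans (if-≡ᵇ-no ≢2n+1) (if-≡ᵇ-yes (+-comm 2 (2 * n)))
    where
    ≢2n+1 : suc (suc (2 * n)) ≢ 2 * n + 1
    ≢2n+1 = λ eq → 1+n≢n (suc-injective (trans eq (+-comm (2 * n) 1)))

extend-agrees : ∀ n y₁ y₂ V {k} → k < fanSize n → extendℕ n y₁ y₂ V (V 0) k ≡ V k
extend-agrees n y₁ y₂ V {zero}  _          = refl
extend-agrees n y₁ y₂ V {suc a} (s≤s a<2n) = extend-old n y₁ y₂ V (V 0) a<2n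

record LeafSource (n y₁ y₂ a : ℕ) : Set where
  field
    source      : ℕ
    source<     : source < 2 * n
    copies      : ∀ V c → extendℕ n y₁ y₂ V c (suc a) ≡ V (suc source)
    mate-copies : ∀ V c → extendℕ n y₁ y₂ V c (suc (mate a)) ≡ V (suc (mate source))

leafSource : ∀ {n p y₁ y₂ a} → p < 2 * n → y₁ ≡ suc p → y₂ ≡ suc (mate p) →
             a < 2 * suc n → LeafSource n y₁ y₂ a
leafSource {n} {p} {a = a} p<2n refl refl a<2n+2
  with m<1+n⇒m<n∨m≡n (subst (a <_) (*-suc 2 n) a<2n+2)
... | inj₂ refl = record
  { source      = mate p
  ; source<     = mate-< n p<2n
  ; copies      = λ V c → extend-new₂ n _ _ V c
  ; mate-copies = λ V c → begin
      extendℕ n _ _ V c (suc (mate (suc (2 * n)))) ≡⟨ cong (extendℕ n _ _ V c ∘ suc) (mate-suc-double n) ⟩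
      extendℕ n _ _ V c (suc (2 * n))              ≡⟨ extend-new₁ n _ _ V c ⟩
      V (suc p)                                    ≡⟨ cong (V ∘ suc) (sym (mate-involutive p)) ⟩
      V (suc (mate (mate p)))                      ∎
  }
  where open ≡-Reasoning
... | inj₁ a<2n+1 with m<1+n⇒m<n∨m≡n a<2n+1
...   | inj₂ refl = record
  { source      = p
  ; source<     = p<2n
  ; copies      = λ V c → extend-new₁ n _ _ V c
  ; mate-copies = λ V c →
      trans (cong (extendℕ n _ _ V c ∘ suc) (mate-double n)) (extend-new₂ n _ _ V c)
  }
...   | inj₁ a<2n = record
  { source      = a
  ; source<     = a<2n
  ; copies      = λ V c → extend-old n _ _ V c a<2n
  ; mate-copies = λ V c → extend-old n _ _ V c (mate-< n a<2n)
  }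

module _ {n p y₁ y₂ : ℕ} {D R : ℕ → ℕ} {q : ℕ}
         (p<2n : p < 2 * n) (y₁≡ : y₁ ≡ suc p) (y₂≡ : y₂ ≡ suc (mate p))
         (pair≡ : R y₁ + R y₂ ≡ q * R 0)
         (s : IsArithmeticalStructureℕ (fanSize n) fanAdjℕ D R) where

  open IsArithmeticalStructureℕ s
  open ≡-Reasoning

  private
    D̃ R̃ : ℕ → ℕ
    D̃ = extendℕ n y₁ y₂ D (D 0 + q)
    R̃ = extendℕ n y₁ y₂ R (R 0)

  extend-pos : ∀ {V c} → 0 < c → (∀ {k} → k < fanSize n → 0 < V k) →
               ∀ {k} → k < fanSize (suc n) → 0 < extendℕ n y₁ y₂ V c k
  extend-pos c>0 V>0 {zero}  _          = c>0
  extend-pos {V} {c} c>0 V>0 {suc a} (s≤s a<2n+2) =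
    subst (0 <_) (sym (copies V c)) (V>0 (s≤s source<))
    where open LeafSource (leafSource p<2n y₁≡ y₂≡ a<2n+2)

  extend-primitive : foldUpTo gcd 0 (fanSize (suc n)) R̃ ≡ 1
  extend-primitive = begin
    foldUpTo gcd 0 (fanSize (suc n)) R̃          ≡⟨ cong (λ M → foldUpTo gcd 0 (suc M) R̃) (*-suc 2 n) ⟩
    foldUpTo gcd 0 (suc (suc (fanSize n))) R̃    ≡⟨ foldUpTo-snoc² {f = gcd} gcd-assoc gcd-identity (fanSize n) R̃ ⟩
    gcd (foldUpTo gcd 0 (fanSize n) R̃) new      ≡⟨ cong (λ g → gcd g new) old-primitive ⟩
    gcd 1 new                                    ≡⟨ gcd-zeroˡ new ⟩
    1                                            ∎
    where
    new : ℕ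
    new = gcd (R̃ (fanSize n)) (R̃ (suc (fanSize n)))
    old-primitive : foldUpTo gcd 0 (fanSize n) R̃ ≡ 1
    old-primitive = trans (foldUpTo-cong gcd 0 (fanSize n) (extend-agrees n y₁ y₂ R)) r-primitive

  extend-center : D̃ 0 * R̃ 0 ≡ sumUpTo (fanSize (suc n)) (λ j → fanAdjℕ 0 j * R̃ j)
  extend-center = begin
    (D 0 + q) * R 0                                ≡⟨ *-distribʳ-+ (R 0) (D 0) q ⟩
    D 0 * R 0 + q * R 0                            ≡⟨ cong₂ _+_ (kernel z<s) (sym pair≡) ⟩
    sumUpTo (fanSize n) (λ j → fanAdjℕ 0 j * R j) + (R y₁ + R y₂)
      ≡⟨ cong₂ _+_ (fan-center-row (2 * n) R) refl ⟩
    sumUpTo (2 * n) (R ∘ suc) + (R y₁ + R y₂)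
      ≡⟨ cong₂ _+_ (foldUpTo-cong _+_ 0 (2 * n) (sym ∘ extend-old n y₁ y₂ R (R 0)))
                   (sym (cong₂ _+_ (extend-new₁ n y₁ y₂ R (R 0)) (extend-new₂ n y₁ y₂ R (R 0)))) ⟩
    sumUpTo (2 * n) (R̃ ∘ suc) + (R̃ (suc (2 * n)) + R̃ (suc (suc (2 * n))))
      ≡⟨ sym (foldUpTo-snoc² {f = _+_} +-assoc +-identity (2 * n) (R̃ ∘ suc)) ⟩
    sumUpTo (suc (suc (2 * n))) (R̃ ∘ suc)         ≡⟨ cong (λ M → sumUpTo M (R̃ ∘ suc)) (sym (*-suc 2 n)) ⟩
    sumUpTo (2 * suc n) (R̃ ∘ suc)                 ≡⟨ sym (fan-center-row (2 * suc n) R̃) ⟩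
    sumUpTo (fanSize (suc n)) (λ j → fanAdjℕ 0 j * R̃ j) ∎

  extend-leaf : ∀ {a} → a < 2 * suc n →
                D̃ (suc a) * R̃ (suc a) ≡ sumUpTo (fanSize (suc n)) (λ j → fanAdjℕ (suc a) j * R̃ j)
  extend-leaf {a} a<2n+2 = begin
    D̃ (suc a) * R̃ (suc a)               ≡⟨ cong₂ _*_ (copies D (D 0 + q)) (copies R (R 0)) ⟩
    D (suc source) * R (suc source)     ≡⟨ kernel (s≤s source<) ⟩
    sumUpTo (fanSize n) (λ j → fanAdjℕ (suc source) j * R j)
      ≡⟨ fan-leaf-row (2 * n) source R (mate-< n source<) ⟩
    R 0 + R (suc (mate source))         ≡⟨ cong (R 0 +_) (sym (mate-copies R (R 0))) ⟩
    R̃ 0 + R̃ (suc (mate a))              ≡⟨ sym (fan-leaf-row (2 * suc n) a R̃ (mate-< (suc n) a<2n+2)) ⟩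
    sumUpTo (fanSize (suc n)) (λ j → fanAdjℕ (suc a) j * R̃ j) ∎
    where open LeafSource (leafSource p<2n y₁≡ y₂≡ a<2n+2)

  extend-isArithmeticalStructureℕ : IsArithmeticalStructureℕ (fanSize (suc n)) fanAdjℕ D̃ R̃
  extend-isArithmeticalStructureℕ = record
    { d-pos       = extend-pos (≤-trans (d-pos z<s) (m≤m+n (D 0) q)) d-pos
    ; r-pos       = extend-pos (r-pos z<s) r-pos
    ; r-primitive = extend-primitive
    ; kernel      = λ { {zero} _ → extend-center ; {suc a} (s≤s a<2n+2) → extend-leaf a<2n+2 }
    }

mainTheorem5 : (n : ℕ) → 1 ≤ n →
    (d r : Vector ℕ (fanSize n)) →
    IsArithmeticalStructure (fanAdj n) d r →
    (m : ℕ) → 1 ≤ m → m ≤ n →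
    (h : at r 0 ∣ (at r (2 * m ∸ 1) + at r (2 * m))) →
    IsArithmeticalStructure (fanAdj (suc n)) (dTilde n m d r h) (rTilde n m r)
mainTheorem5 n _ d r s (suc m) _ m<n h =
  toℕ-isArithmeticalStructure fanAdjℕ
    (extend-isArithmeticalStructureℕ (*-monoʳ-< 2 m<n) y₁≡ y₂≡ (_∣_.equality h)
      (at-isArithmeticalStructure fanAdjℕ s))
  where
  y₁≡ : 2 * suc m ∸ 1 ≡ suc (2 * m)
  y₁≡ = cong (_∸ 1) (*-suc 2 m)
  y₂≡ : 2 * suc m ≡ suc (mate (2 * m))
  y₂≡ = trans (*-suc 2 m) (cong suc (sym (mate-double m)))
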